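{- Let $N\ge 3$ and let $W_{N+1}$ be the wheel graph with vertices $v_0,\dots,v_N$, where $v_0,\dots,v_{N-1}$ form a cycle (edges $v_iv_{i+1}$, indices mod $N$) and the central vertex $v_N$ is adjacent to every $v_i$, $0\le i\le N-1$. Regard $W_{N+1}$ as an electrical network with every edge a unit resistor, and let $r(W_{N+1};i,j)$ be the effective resistance between $v_i$ and $v_j$. Then for $1\le \ell\le N-1$, \[ r(W_{N+1};0,\ell)=\begin{cases}\dfrac{2(F_N-F_{N-2\ell})}{F_{N-1}+F_{N+1}} & \text{if } N \text{ is odd},\\[2mm] \dfrac{2(L_N-L_{N-2\ell})}{L_{N-1}+L_{N+1}} & \text{if } N \text{ is even}.\end{cases} \]
   Context: $F_n$ denotes the Fibonacci numbers ($F_0=0$, $F_1=1$, $F_{n+2}=F_{n+1}+F_n$) and $L_n$ the Lucas numbers ($L_0=2$, $L_1=1$, $L_{n+2}=L_{n+1}+L_n$), both extended to negative indices by the same recurrence (so $F_{ -n}=(-1)^{n+1}F_n$, $L_{ -n}=(-1)^nL_n$). -}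

module Defs where

open import Data.Bool using (Bool; true; false; _∧_; _∨_; not; if_then_else_)
open import Data.Nat as ℕ using (ℕ; zero; suc; _≡ᵇ_; NonZero)
open import Data.Integer as ℤ using (ℤ; +_; -[1+_])
open import Data.Fin as Fin using (Fin; toℕ)
import Data.Nat.Properties as NP
open import Data.Rational using (ℚ; 0ℚ; 1ℚ; _-_; _+_; _/_)
open import Data.Product using (Σ; _×_)
open import Relation.Binary.PropositionalEquality using (_≡_)

fib : ℕ → ℕ
fib zero = 0
fib (suc zero) = 1
fib (suc (suc n)) = fib (suc n) ℕ.+ fib n

luc : ℕ → ℕ
luc zero = 2
luc (suc zero) = 1
luc (suc (suc n)) = luc (suc n) ℕ.+ luc n

sgn : ℕ → ℤ
sgn zero = ℤ.+ 1
sgn (suc n) = ℤ.- sgn n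

-- F_n for integer n, with F_{-m} = (-1)^{m+1} F_m
F : ℤ → ℤ
F (+ n) = + fib n
F -[1+ n ] = sgn n ℤ.* (+ fib (suc n))

-- L_n for integer n, with L_{-m} = (-1)^m L_m
L : ℤ → ℤ
L (+ n) = + luc n
L -[1+ n ] = sgn (suc n) ℤ.* (+ luc (suc n))

-- Positivity of the denominators F_{N-1}+F_{N+1} and L_{N-1}+L_{N+1}
-- (written for N = suc m)

fib-pos : ∀ k → 0 ℕ.< fib (suc k)
fib-pos zero = ℕ.s≤s ℕ.z≤n
fib-pos (suc k) = NP.≤-trans (fib-pos k) (NP.m≤m+n (fib (suc k)) (fib k))

luc-pos : ∀ k → 0 ℕ.< luc k
luc-pos zero = ℕ.s≤s ℕ.z≤n
luc-pos (suc zero) = ℕ.s≤s ℕ.z≤n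
luc-pos (suc (suc k)) = NP.≤-trans (luc-pos (suc k)) (NP.m≤m+n (luc (suc k)) (luc k))

fib-den-nz : ∀ m → NonZero (fib m ℕ.+ fib (suc (suc m)))
fib-den-nz m = ℕ.>-nonZero (NP.≤-trans (fib-pos (suc m)) (NP.m≤n+m _ (fib m)))

luc-den-nz : ∀ m → NonZero (luc m ℕ.+ luc (suc (suc m)))
luc-den-nz m = ℕ.>-nonZero (NP.≤-trans (luc-pos (suc (suc m))) (NP.m≤n+m _ (luc m)))

wheelAdjℕ : ℕ → ℕ → ℕ → Bool
wheelAdjℕ N a b =
  not (a ≡ᵇ b) ∧
  ( (a ≡ᵇ N) ∨ (b ≡ᵇ N)
  ∨ (b ≡ᵇ suc a) ∨ (a ≡ᵇ suc b)
  ∨ ((a ≡ᵇ 0) ∧ (suc b ≡ᵇ N)) ∨ ((b ≡ᵇ 0) ∧ (suc a ≡ᵇ N)) )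

wheelAdj : (N : ℕ) → Fin (suc N) → Fin (suc N) → Bool
wheelAdj N u w = wheelAdjℕ N (toℕ u) (toℕ w)

sumFin : (n : ℕ) → (Fin n → ℚ) → ℚ
sumFin zero f = 0ℚ
sumFin (suc n) f = f Fin.zero + sumFin n (λ i → f (Fin.suc i))

-- (L φ)(u) = Σ_{w ~ u} (φ u - φ w): net current leaving u when the
-- vertex potentials are φ and every edge is a unit resistor.
laplacian : (n : ℕ) → (Fin n → Fin n → Bool) → (Fin n → ℚ) → Fin n → ℚ
laplacian n adj φ u = sumFin n (λ w → if adj u w then φ u - φ w else 0ℚ)

-- external current: +1 into i, -1 at j (0 if i = j)
unitCurrent : (n : ℕ) → Fin n → Fin n → Fin n → ℚ
unitCurrent n i j u =
  (if toℕ u ≡ᵇ toℕ i then 1ℚ else 0ℚ) - (if toℕ u ≡ᵇ toℕ j then 1ℚ else 0ℚ)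

IsPotential : (n : ℕ) → (Fin n → Fin n → Bool) → Fin n → Fin n → (Fin n → ℚ) → Set
IsPotential n adj i j φ = ∀ u → laplacian n adj φ u ≡ unitCurrent n i j u

IsEffectiveResistance : (n : ℕ) → (Fin n → Fin n → Bool) → Fin n → Fin n → ℚ → Set
IsEffectiveResistance n adj i j r =
  Σ (Fin n → ℚ) (IsPotential n adj i j)
  × (∀ φ → IsPotential n adj i j φ → φ i - φ j ≡ r)

Odd : ℕ → Set
Odd n = Σ ℕ λ k → n ≡ suc (k ℕ.* 2)

Even : ℕ → Set
Even n = Σ ℕ λ k → n ≡ k ℕ.* 2

-- The formulas oddFormula N l, evenFormula N l; for N = suc m (so N-1 = m, N+1 = suc (suc m)):
-- 2(F_N - F_{N-2l}) / (F_{N-1} + F_{N+1})  and the Lucas analogue.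

-- (The N = 0 clauses are never used: the theorem assumes N ≥ 3.)
oddFormula : ℕ → ℕ → ℚ
oddFormula zero l = 0ℚ
oddFormula (suc m) l =
  _/_ (ℤ.+ 2 ℤ.* (F (+ suc m) ℤ.- F (+ suc m ℤ.- + (2 ℕ.* l))))
      (fib m ℕ.+ fib (suc (suc m))) {{fib-den-nz m}}

evenFormula : ℕ → ℕ → ℚ
evenFormula zero l = 0ℚ
evenFormula (suc m) l =
  _/_ (ℤ.+ 2 ℤ.* (L (+ suc m) ℤ.- L (+ suc m ℤ.- + (2 ℕ.* l))))
      (luc m ℕ.+ luc (suc (suc m))) {{luc-den-nz m}}

{-# OPTIONS --safe #-}
module Submission where

-- Ground the hub and unroll the rim to ℤ. Let G be F for odd N and L for even N, and
-- g(t) = G_{N−2t}. Then g(t+1) + g(t−1) = 3g(t), and g(N−t) = g(t) because G_{−x} = G_x for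
-- x ≡ N (mod 2). Hence j ↦ g(|j−a|) is harmonic on the rim away from a, also across the seam
-- between v_{N−1} and v_0, while its Laplacian at a is 3G_N − 2G_{N−2} = G_{N−1} + G_{N+1} =: D.
-- So (g(|j|) − g(|j−ℓ|))/D is a potential for a unit current from v_0 to v_ℓ (the equation at the
-- hub is implied by the others, as Kirchhoff's equations sum to zero), and its drop is
-- 2(G_N − G_{N−2ℓ})/D. Green's reciprocity Σ φ·Lψ = Σ ψ·Lφ gives every such potential this drop.

open import Defs
open import Algebra.Bundles using (Ring)
open import Data.Bool using (Bool; true; false; T; if_then_else_)
open import Data.Unit using (tt)
open import Data.Fin as Fin using (Fin; zero; suc; toℕ; fromℕ<)
import Data.Fin.Properties as FinP
open import Data.Nat as ℕ using (ℕ; zero; suc; _≟_; _≡ᵇ_; _<_; _≤_; z≤n; s≤s; NonZero)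
import Data.Nat.Properties as ℕP
open import Data.Rational as ℚ using (ℚ; 0ℚ; 1ℚ; toℚᵘ)
open import Data.Rational.Unnormalised as ℚᵘ using (mkℚᵘ; *≡*)
import Data.Rational.Unnormalised.Properties as ℚᵘP
open import Data.Integer as ℤ using (ℤ; 0ℤ; 1ℤ)
import Data.Integer.Properties as ℤP
open import Data.Integer.Tactic.RingSolver using (solve-∀)
import Data.Rational.Properties as ℚP
open import Data.Rational.Solver using (module +-*-Solver)
open import Data.Product using (_×_; _,_; proj₁; proj₂)
open import Data.Sum using (_⊎_; inj₁; inj₂)
open import Function using (_∘_; _⇔_; Equivalence; mk⇔)
open import Relation.Nullary using (Dec; yes; no; does; contradiction; ¬?; _×-dec_; _⊎-dec_)
open import Relation.Nullary.Decidable using (dec-true; dec-false)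
open import Relation.Binary.PropositionalEquality

open import Algebra.Properties.Semiring.Sum (Ring.semiring ℚP.+-*-ring)
import Algebra.Properties.Group ℚP.+-0-group as ℚ-Group
import Algebra.Properties.AbelianGroup ℤP.+-0-abelianGroup as ℤ-Group

if-≡ᵇ-self : ∀ {A : Set} i (x y : A) → (if i ≡ᵇ i then x else y) ≡ x
if-≡ᵇ-self i x y = cong (if_then x else y) (dec-true (i ≟ i) refl)

if-≡ᵇ-≢ : ∀ {A : Set} {i j} (x y : A) → i ≢ j → (if i ≡ᵇ j then x else y) ≡ y
if-≡ᵇ-≢ {i = i} {j} x y i≢j = cong (if_then x else y) (dec-false (i ≟ j) i≢j)

module _ where
  open import Data.Rational using (_+_; _-_; _*_; -_)

  sumFin≡sum : ∀ n (f : Fin n → ℚ) → sumFin n f ≡ sum f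
  sumFin≡sum zero    f = refl
  sumFin≡sum (suc n) f = cong (f zero +_) (sumFin≡sum n (f ∘ suc))

  ∑-neg : ∀ {n} (f : Fin n → ℚ) → ∑[ i < n ] (- f i) ≡ - sum f
  ∑-neg {zero}  f = refl
  ∑-neg {suc n} f = trans (cong (- f zero +_) (∑-neg (f ∘ suc))) (sym (ℚP.neg-distrib-+ (f zero) _))

  ∑-distrib-- : ∀ {n} (f g : Fin n → ℚ) → ∑[ i < n ] (f i - g i) ≡ sum f - sum g
  ∑-distrib-- f g = trans (∑-distrib-+ f (-_ ∘ g)) (cong (sum f +_) (∑-neg g))

  ∑-pick : ∀ {n} (f : Fin n → ℚ) (i : Fin n) → (∀ u → u ≢ i → f u ≡ 0ℚ) → sum f ≡ f i
  ∑-pick {suc n} f zero    off = begin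
    f zero + ∑[ u < n ] f (suc u) ≡⟨ cong (f zero +_) (sum-cong-≗ (λ u → off (suc u) λ ())) ⟩
    f zero + sum {n} (λ _ → 0ℚ)  ≡⟨ cong (f zero +_) (sum-replicate-zero n) ⟩
    f zero + 0ℚ                  ≡⟨ ℚP.+-identityʳ (f zero) ⟩
    f zero                       ∎
    where open ≡-Reasoning
  ∑-pick {suc n} f (suc i) off = begin
    f zero + ∑[ u < n ] f (suc u) ≡⟨ cong₂ _+_ (off zero λ ()) (∑-pick (f ∘ suc) i off-suc) ⟩
    0ℚ + f (suc i)                ≡⟨ ℚP.+-identityˡ (f (suc i)) ⟩
    f (suc i)                     ∎
    where
    open ≡-Reasoning
    off-suc : ∀ u → u ≢ i → f (suc u) ≡ 0ℚ
    off-suc u u≢i = off (suc u) (u≢i ∘ FinP.suc-injective)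

  onlyAt : (ℕ → ℚ) → ℕ → ℕ → ℚ
  onlyAt f a j = if j ≡ᵇ a then f a else 0ℚ

  onlyAt-self : ∀ f a → onlyAt f a a ≡ f a
  onlyAt-self f a = if-≡ᵇ-self a (f a) 0ℚ

  onlyAt-off : ∀ f {a j} → j ≢ a → onlyAt f a j ≡ 0ℚ
  onlyAt-off f {a} = if-≡ᵇ-≢ (f a) 0ℚ

  ∑-onlyAt : ∀ {n a} (f : ℕ → ℚ) → a < n → ∑[ u < n ] onlyAt f a (toℕ u) ≡ f a
  ∑-onlyAt {n} {a} f a<n = begin
    ∑[ u < n ] onlyAt f a (toℕ u)  ≡⟨ ∑-pick (λ u → onlyAt f a (toℕ u)) (fromℕ< a<n) off ⟩
    onlyAt f a (toℕ (fromℕ< a<n))  ≡⟨ cong (onlyAt f a) (FinP.toℕ-fromℕ< a<n) ⟩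
    onlyAt f a a                   ≡⟨ onlyAt-self f a ⟩
    f a                            ∎
    where
    open ≡-Reasoning
    off : ∀ u → u ≢ fromℕ< a<n → onlyAt f a (toℕ u) ≡ 0ℚ
    off u u≢a = onlyAt-off f λ u≡a → u≢a (FinP.toℕ-injective (trans u≡a (sym (FinP.toℕ-fromℕ< a<n))))

  if-three-points : ∀ {a b c} (p : ℕ → Bool) (f : ℕ → ℚ) → a ≢ b → a ≢ c → b ≢ c →
    (∀ j → T (p j) ⇔ (j ≡ a ⊎ j ≡ b ⊎ j ≡ c)) →
    ∀ j → (if p j then f j else 0ℚ) ≡ onlyAt f a j + (onlyAt f b j + onlyAt f c j)
  if-three-points {a} {b} {c} p f a≢b a≢c b≢c p⇔ j with p j in pj
  ... | true with Equivalence.to (p⇔ j) (subst T (sym pj) _)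
  ...   | inj₁ refl = sym (begin
    onlyAt f a a + (onlyAt f b a + onlyAt f c a)
      ≡⟨ cong₂ _+_ (onlyAt-self f a) (cong₂ _+_ (onlyAt-off f a≢b) (onlyAt-off f a≢c)) ⟩
    f a + 0ℚ             ≡⟨ ℚP.+-identityʳ (f a) ⟩
    f a                  ∎)
    where open ≡-Reasoning
  ...   | inj₂ (inj₁ refl) = sym (begin
    onlyAt f a b + (onlyAt f b b + onlyAt f c b)
      ≡⟨ cong₂ _+_ (onlyAt-off f (a≢b ∘ sym)) (cong₂ _+_ (onlyAt-self f b) (onlyAt-off f b≢c)) ⟩
    0ℚ + (f b + 0ℚ)      ≡⟨ trans (ℚP.+-identityˡ _) (ℚP.+-identityʳ (f b)) ⟩
    f b                  ∎)
    where open ≡-Reasoning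
  ...   | inj₂ (inj₂ refl) = sym (begin
    onlyAt f a c + (onlyAt f b c + onlyAt f c c)
      ≡⟨ cong₂ _+_ (onlyAt-off f (a≢c ∘ sym)) (cong₂ _+_ (onlyAt-off f (b≢c ∘ sym)) (onlyAt-self f c)) ⟩
    0ℚ + (0ℚ + f c)      ≡⟨ trans (ℚP.+-identityˡ _) (ℚP.+-identityˡ (f c)) ⟩
    f c                  ∎)
    where open ≡-Reasoning
  if-three-points {a} {b} {c} p f _ _ _ p⇔ j | false = sym (trans
    (cong₂ _+_ (onlyAt-off f (absent (inj₁ refl)))
               (cong₂ _+_ (onlyAt-off f (absent (inj₂ (inj₁ refl)))) (onlyAt-off f (absent (inj₂ (inj₂ refl))))))
    (ℚP.+-identityʳ 0ℚ))
    where
    absent : ∀ {x} → x ≡ a ⊎ x ≡ b ⊎ x ≡ c → j ≢ x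
    absent x∈ refl = subst T pj (Equivalence.from (p⇔ j) x∈)

  ∑-over-three-points : ∀ {n a b c} (p : ℕ → Bool) (f : ℕ → ℚ) →
    a < n → b < n → c < n → a ≢ b → a ≢ c → b ≢ c →
    (∀ j → T (p j) ⇔ (j ≡ a ⊎ j ≡ b ⊎ j ≡ c)) →
    ∑[ u < n ] (if p (toℕ u) then f (toℕ u) else 0ℚ) ≡ f a + (f b + f c)
  ∑-over-three-points {n} {a} {b} {c} p f a<n b<n c<n a≢b a≢c b≢c p⇔ = begin
    ∑[ u < n ] (if p (toℕ u) then f (toℕ u) else 0ℚ)
      ≡⟨ sum-cong-≗ {n} (λ u → if-three-points p f a≢b a≢c b≢c p⇔ (toℕ u)) ⟩
    ∑[ u < n ] (δ a u + (δ b u + δ c u))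
      ≡⟨ ∑-distrib-+ {n} (δ a) (λ u → δ b u + δ c u) ⟩
    ∑[ u < n ] δ a u + ∑[ u < n ] (δ b u + δ c u)
      ≡⟨ cong (∑[ u < n ] δ a u +_) (∑-distrib-+ {n} (δ b) (δ c)) ⟩
    ∑[ u < n ] δ a u + (∑[ u < n ] δ b u + ∑[ u < n ] δ c u)
      ≡⟨ cong₂ _+_ (∑-onlyAt f a<n) (cong₂ _+_ (∑-onlyAt f b<n) (∑-onlyAt f c<n)) ⟩
    f a + (f b + f c) ∎
    where
    open ≡-Reasoning
    δ : ℕ → Fin n → ℚ
    δ x u = onlyAt f x (toℕ u)

  ι : Bool → ℚ
  ι b = if b then 1ℚ else 0ℚ

  if≡ι* : ∀ b x → (if b then x else 0ℚ) ≡ ι b * x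
  if≡ι* true  x = sym (ℚP.*-identityˡ x)
  if≡ι* false x = sym (ℚP.*-zeroˡ x)

  ∑-*-unitCurrent : ∀ {n} (ψ : Fin n → ℚ) i j → ∑[ u < n ] (ψ u * unitCurrent n i j u) ≡ ψ i - ψ j
  ∑-*-unitCurrent {n} ψ i j = begin
    ∑[ u < n ] (ψ u * unitCurrent n i j u)
      ≡⟨ sum-cong-≗ {n} (λ u → *-distrib-- (ψ u) (ι (toℕ u ≡ᵇ toℕ i)) (ι (toℕ u ≡ᵇ toℕ j))) ⟩
    ∑[ u < n ] (ψ u * ι (toℕ u ≡ᵇ toℕ i) - ψ u * ι (toℕ u ≡ᵇ toℕ j))
      ≡⟨ ∑-distrib-- {n} _ _ ⟩
    ∑[ u < n ] (ψ u * ι (toℕ u ≡ᵇ toℕ i)) - ∑[ u < n ] (ψ u * ι (toℕ u ≡ᵇ toℕ j))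
      ≡⟨ cong₂ _-_ (select i) (select j) ⟩
    ψ i - ψ j ∎
    where
    open ≡-Reasoning
    open +-*-Solver
    *-distrib-- : ∀ x a b → x * (a - b) ≡ x * a - x * b
    *-distrib-- = solve 3 (λ x a b → x :* (a :- b) := x :* a :- x :* b) refl
    select : ∀ k → ∑[ u < n ] (ψ u * ι (toℕ u ≡ᵇ toℕ k)) ≡ ψ k
    select k = trans (∑-pick {n} _ k off)
                     (trans (cong (λ b → ψ k * ι b) (dec-true (toℕ k ≟ toℕ k) refl)) (ℚP.*-identityʳ (ψ k)))
      where
      off : ∀ u → u ≢ k → ψ u * ι (toℕ u ≡ᵇ toℕ k) ≡ 0ℚ
      off u u≢k = trans (cong (λ b → ψ u * ι b) (dec-false (toℕ u ≟ toℕ k) (u≢k ∘ FinP.toℕ-injective)))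
                        (ℚP.*-zeroʳ (ψ u))

  module Network {n} (adj : Fin n → Fin n → Bool) (adj-sym : ∀ u w → adj u w ≡ adj w u) where

    laplacian-as-∑ : ∀ φ u → laplacian n adj φ u ≡ ∑[ w < n ] (ι (adj u w) * (φ u - φ w))
    laplacian-as-∑ φ u = trans (sumFin≡sum n _) (sum-cong-≗ {n} (λ w → if≡ι* (adj u w) (φ u - φ w)))

    dirichlet : (Fin n → ℚ) → (Fin n → ℚ) → ℚ
    dirichlet φ ψ = ∑[ u < n ] (φ u * laplacian n adj ψ u)

    diagonal cross : (Fin n → ℚ) → (Fin n → ℚ) → ℚ
    diagonal φ ψ = ∑[ u < n ] ∑[ w < n ] (ι (adj u w) * (φ u * ψ u))
    cross    φ ψ = ∑[ u < n ] ∑[ w < n ] (ι (adj u w) * (φ u * ψ w))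

    dirichlet-expand : ∀ φ ψ → dirichlet φ ψ ≡ diagonal φ ψ - cross φ ψ
    dirichlet-expand φ ψ = trans (sum-cong-≗ {n} row) (∑-distrib-- {n} _ _)
      where
      open ≡-Reasoning
      open +-*-Solver
      distrib : ∀ a x y z → x * (a * (y - z)) ≡ a * (x * y) - a * (x * z)
      distrib = solve 4 (λ a x y z → x :* (a :* (y :- z)) := a :* (x :* y) :- a :* (x :* z)) refl
      row : ∀ u → φ u * laplacian n adj ψ u ≡
                  ∑[ w < n ] (ι (adj u w) * (φ u * ψ u)) - ∑[ w < n ] (ι (adj u w) * (φ u * ψ w))
      row u = begin
        φ u * laplacian n adj ψ u
          ≡⟨ cong (φ u *_) (laplacian-as-∑ ψ u) ⟩
        φ u * ∑[ w < n ] (ι (adj u w) * (ψ u - ψ w))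
          ≡⟨ *-distribˡ-sum {n} (φ u) _ ⟩
        ∑[ w < n ] (φ u * (ι (adj u w) * (ψ u - ψ w)))
          ≡⟨ sum-cong-≗ {n} (λ w → distrib (ι (adj u w)) (φ u) (ψ u) (ψ w)) ⟩
        ∑[ w < n ] (ι (adj u w) * (φ u * ψ u) - ι (adj u w) * (φ u * ψ w))
          ≡⟨ ∑-distrib-- {n} _ _ ⟩
        ∑[ w < n ] (ι (adj u w) * (φ u * ψ u)) - ∑[ w < n ] (ι (adj u w) * (φ u * ψ w)) ∎

    laplacian-reciprocity : ∀ φ ψ → dirichlet φ ψ ≡ dirichlet ψ φ
    laplacian-reciprocity φ ψ = begin
      dirichlet φ ψ             ≡⟨ dirichlet-expand φ ψ ⟩
      diagonal φ ψ - cross φ ψ  ≡⟨ cong₂ _-_ diagonal-sym cross-sym ⟩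
      diagonal ψ φ - cross ψ φ  ≡⟨ dirichlet-expand ψ φ ⟨
      dirichlet ψ φ             ∎
      where
      open ≡-Reasoning
      diagonal-sym : diagonal φ ψ ≡ diagonal ψ φ
      diagonal-sym = sum-cong-≗ {n} λ u → sum-cong-≗ {n} λ w → cong (ι (adj u w) *_) (ℚP.*-comm (φ u) (ψ u))
      cross-sym : cross φ ψ ≡ cross ψ φ
      cross-sym = trans (∑-comm {n} {n} _) (sum-cong-≗ {n} λ w → sum-cong-≗ {n} λ u →
                    cong₂ _*_ (cong ι (adj-sym u w)) (ℚP.*-comm (φ u) (ψ w)))

    ∑-laplacian : ∀ φ → ∑[ u < n ] laplacian n adj φ u ≡ 0ℚ
    ∑-laplacian φ = begin
      ∑[ u < n ] laplacian n adj φ u  ≡⟨ sum-cong-≗ {n} (λ u → ℚP.*-identityˡ _) ⟨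
      dirichlet (λ _ → 1ℚ) φ          ≡⟨ laplacian-reciprocity (λ _ → 1ℚ) φ ⟩
      dirichlet φ (λ _ → 1ℚ)          ≡⟨ sum-cong-≗ {n} (λ u → trans (cong (φ u *_) (constant-harmonic u))
                                                                     (ℚP.*-zeroʳ (φ u))) ⟩
      ∑[ u < n ] 0ℚ                   ≡⟨ sum-replicate-zero n ⟩
      0ℚ                              ∎
      where
      open ≡-Reasoning
      constant-harmonic : ∀ u → laplacian n adj (λ _ → 1ℚ) u ≡ 0ℚ
      constant-harmonic u = trans (laplacian-as-∑ (λ _ → 1ℚ) u)
        (trans (sum-cong-≗ {n} (λ w → ℚP.*-zeroʳ (ι (adj u w)))) (sum-replicate-zero n))

    potential-drop-unique : ∀ {i j φ ψ} → IsPotential n adj i j φ → IsPotential n adj i j ψ →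
                            ψ i - ψ j ≡ φ i - φ j
    potential-drop-unique {i} {j} {φ} {ψ} φ-pot ψ-pot = begin
      ψ i - ψ j                               ≡⟨ ∑-*-unitCurrent ψ i j ⟨
      ∑[ u < n ] (ψ u * unitCurrent n i j u)  ≡⟨ sum-cong-≗ {n} (λ u → cong (ψ u *_) (φ-pot u)) ⟨
      dirichlet ψ φ                           ≡⟨ laplacian-reciprocity ψ φ ⟩
      dirichlet φ ψ                           ≡⟨ sum-cong-≗ {n} (λ u → cong (φ u *_) (ψ-pot u)) ⟩
      ∑[ u < n ] (φ u * unitCurrent n i j u)  ≡⟨ ∑-*-unitCurrent φ i j ⟩
      φ i - φ j                               ∎
      where open ≡-Reasoning

    isEffectiveResistance : ∀ {i j φ} → IsPotential n adj i j φ → IsEffectiveResistance n adj i j (φ i - φ j)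
    isEffectiveResistance {φ = φ} φ-pot = (φ , φ-pot) , λ ψ ψ-pot → potential-drop-unique {φ = φ} {ψ} φ-pot ψ-pot

    isPotential-except : ∀ {i j φ} (z : Fin n) →
                         (∀ u → u ≢ z → laplacian n adj φ u ≡ unitCurrent n i j u) → IsPotential n adj i j φ
    isPotential-except {i} {j} {φ} z off-z u with u Fin.≟ z
    ... | no u≢z   = off-z u u≢z
    ... | yes refl = ℚ-Group.x∙y⁻¹≈ε⇒x≈y _ _ (begin
      residual z           ≡⟨ ∑-pick {n} residual z (λ u u≢z → x≈y⇒x-y≈0 (off-z u u≢z)) ⟨
      ∑[ u < n ] residual u ≡⟨ ∑-distrib-- {n} _ _ ⟩
      ∑[ u < n ] laplacian n adj φ u - ∑[ u < n ] unitCurrent n i j u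
                            ≡⟨ cong₂ _-_ (∑-laplacian φ) ∑-unitCurrent ⟩
      0ℚ - 0ℚ               ≡⟨ ℚP.+-inverseʳ 0ℚ ⟩
      0ℚ                    ∎)
      where
      open ≡-Reasoning
      x≈y⇒x-y≈0 = ℚ-Group.x≈y⇒x∙y⁻¹≈ε
      residual : Fin n → ℚ
      residual u = laplacian n adj φ u - unitCurrent n i j u
      ∑-unitCurrent : ∑[ u < n ] unitCurrent n i j u ≡ 0ℚ
      ∑-unitCurrent = begin
        ∑[ u < n ] unitCurrent n i j u         ≡⟨ sum-cong-≗ {n} (λ u → ℚP.*-identityˡ _) ⟨
        ∑[ u < n ] (1ℚ * unitCurrent n i j u)  ≡⟨ ∑-*-unitCurrent (λ _ → 1ℚ) i j ⟩
        1ℚ - 1ℚ                                ≡⟨ ℚP.+-inverseʳ 1ℚ ⟩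
        0ℚ                                     ∎

WheelEdge : ℕ → ℕ → ℕ → Set
WheelEdge N a b = a ≢ b ×
  (a ≡ N ⊎ b ≡ N ⊎ b ≡ suc a ⊎ a ≡ suc b ⊎ (a ≡ 0 × suc b ≡ N) ⊎ (b ≡ 0 × suc a ≡ N))

-- does (wheelEdge? N a b) unfolds to wheelAdjℕ N a b.
wheelEdge? : ∀ N a b → Dec (WheelEdge N a b)
wheelEdge? N a b = ¬? (a ≟ b) ×-dec
  (a ≟ N ⊎-dec b ≟ N ⊎-dec b ≟ suc a ⊎-dec a ≟ suc b ⊎-dec (a ≟ 0 ×-dec suc b ≟ N) ⊎-dec (b ≟ 0 ×-dec suc a ≟ N))

T-does : ∀ {P : Set} (P? : Dec P) → T (does P?) ⇔ P
T-does (yes p) = mk⇔ (λ _ → p) (λ _ → tt)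
T-does (no ¬p) = mk⇔ (λ ()) ¬p

T-wheelAdjℕ : ∀ N a b → T (wheelAdjℕ N a b) ⇔ WheelEdge N a b
T-wheelAdjℕ N a b = T-does (wheelEdge? N a b)

wheelEdge-sym : ∀ {N a b} → WheelEdge N a b → WheelEdge N b a
wheelEdge-sym (a≢b , edge) = (a≢b ∘ sym) , swap edge
  where
  swap : ∀ {N a b} → a ≡ N ⊎ b ≡ N ⊎ b ≡ suc a ⊎ a ≡ suc b ⊎ (a ≡ 0 × suc b ≡ N) ⊎ (b ≡ 0 × suc a ≡ N) →
                     b ≡ N ⊎ a ≡ N ⊎ a ≡ suc b ⊎ b ≡ suc a ⊎ (b ≡ 0 × suc a ≡ N) ⊎ (a ≡ 0 × suc b ≡ N)
  swap (inj₁ e)                               = inj₂ (inj₁ e)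
  swap (inj₂ (inj₁ e))                        = inj₁ e
  swap (inj₂ (inj₂ (inj₁ e)))                 = inj₂ (inj₂ (inj₂ (inj₁ e)))
  swap (inj₂ (inj₂ (inj₂ (inj₁ e))))          = inj₂ (inj₂ (inj₁ e))
  swap (inj₂ (inj₂ (inj₂ (inj₂ (inj₁ e)))))   = inj₂ (inj₂ (inj₂ (inj₂ (inj₂ e))))
  swap (inj₂ (inj₂ (inj₂ (inj₂ (inj₂ e)))))   = inj₂ (inj₂ (inj₂ (inj₂ (inj₁ e))))

wheelAdjℕ-sym : ∀ N a b → wheelAdjℕ N a b ≡ wheelAdjℕ N b a
wheelAdjℕ-sym N a b = agree (wheelEdge? N b a)
  where
  agree : (ba? : Dec (WheelEdge N b a)) → does (wheelEdge? N a b) ≡ does ba?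
  agree (yes ba) = dec-true  (wheelEdge? N a b) (wheelEdge-sym ba)
  agree (no ¬ba) = dec-false (wheelEdge? N a b) (¬ba ∘ wheelEdge-sym)

module Rim (p : ℕ) where
  open import Data.Rational using (_+_)

  m N : ℕ
  m = suc (suc p)
  N = suc m

  next prev : ℕ → ℕ
  next i = if i ≡ᵇ m then 0 else suc i
  prev zero    = m
  prev (suc i) = i

  next-last : next m ≡ 0
  next-last = if-≡ᵇ-self m 0 (suc m)

  next-≢ : ∀ {i} → i ≢ m → next i ≡ suc i
  next-≢ = if-≡ᵇ-≢ 0 _

  next≤m : ∀ {i} → i ≤ m → next i ≤ m
  next≤m {i} i≤m with i ≟ m
  ... | yes refl = subst (_≤ m) (sym next-last) z≤n
  ... | no  i≢m  = subst (_≤ m) (sym (next-≢ i≢m)) (ℕP.≤∧≢⇒< i≤m i≢m)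

  prev≤m : ∀ {i} → i ≤ m → prev i ≤ m
  prev≤m {zero}  _   = ℕP.≤-refl
  prev≤m {suc i} i<m = ℕP.<⇒≤ i<m

  next≢prev : ∀ {i} → i ≤ m → next i ≢ prev i
  next≢prev {i} i≤m with i ≟ m
  next≢prev {.m}    _ | yes refl = λ next≡prev → 0≢1+n (trans (sym next-last) next≡prev)
    where
    0≢1+n : ∀ {n} → 0 ≢ suc n
    0≢1+n ()
  next≢prev {zero}  _ | no i≢m = λ ()
  next≢prev {suc i} _ | no i≢m = λ next≡prev →
    ℕP.<⇒≢ (ℕP.m≤n⇒m≤1+n (ℕP.n<1+n i)) (sym (trans (sym (next-≢ i≢m)) next≡prev))

  rim≢hub : ∀ {i} → i ≤ m → i ≢ N
  rim≢hub i≤m refl = ℕP.<-irrefl refl i≤m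

  next-edge : ∀ i → WheelEdge N i (next i)
  next-edge i with i ≟ m
  ... | yes refl = subst (WheelEdge N m) (sym next-last) ((λ ()) , inj₂ (inj₂ (inj₂ (inj₂ (inj₂ (refl , refl))))))
  ... | no  i≢m  = subst (WheelEdge N i) (sym (next-≢ i≢m)) ((ℕP.1+n≢n ∘ sym) , inj₂ (inj₂ (inj₁ refl)))

  prev-edge : ∀ i → WheelEdge N i (prev i)
  prev-edge zero    = (λ ()) , inj₂ (inj₂ (inj₂ (inj₂ (inj₁ (refl , refl)))))
  prev-edge (suc i) = ℕP.1+n≢n , inj₂ (inj₂ (inj₂ (inj₁ refl)))

  wheel-neighbours : ∀ {i} → i ≤ m → ∀ j → T (wheelAdjℕ N i j) ⇔ (j ≡ N ⊎ j ≡ next i ⊎ j ≡ prev i)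
  wheel-neighbours {i} i≤m j = mk⇔ (neighbour ∘ proj₂ ∘ Equivalence.to (T-wheelAdjℕ N i j))
                                    (Equivalence.from (T-wheelAdjℕ N i j) ∘ edge)
    where
    neighbour : i ≡ N ⊎ j ≡ N ⊎ j ≡ suc i ⊎ i ≡ suc j ⊎ (i ≡ 0 × suc j ≡ N) ⊎ (j ≡ 0 × suc i ≡ N) →
                j ≡ N ⊎ j ≡ next i ⊎ j ≡ prev i
    neighbour (inj₁ i≡N) = contradiction i≡N (rim≢hub i≤m)
    neighbour (inj₂ (inj₁ j≡N)) = inj₁ j≡N
    neighbour (inj₂ (inj₂ (inj₁ refl))) with i ≟ m
    ... | yes refl = inj₁ refl
    ... | no  i≢m  = inj₂ (inj₁ (sym (next-≢ i≢m)))
    neighbour (inj₂ (inj₂ (inj₂ (inj₁ refl)))) = inj₂ (inj₂ refl)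
    neighbour (inj₂ (inj₂ (inj₂ (inj₂ (inj₁ (refl , refl)))))) = inj₂ (inj₂ refl)
    neighbour (inj₂ (inj₂ (inj₂ (inj₂ (inj₂ (refl , refl)))))) = inj₂ (inj₁ (sym next-last))
    edge : j ≡ N ⊎ j ≡ next i ⊎ j ≡ prev i → WheelEdge N i j
    edge (inj₁ refl)        = rim≢hub i≤m , inj₂ (inj₁ refl)
    edge (inj₂ (inj₁ refl)) = next-edge i
    edge (inj₂ (inj₂ refl)) = prev-edge i

  ∑-wheel-neighbours : ∀ {i} → i ≤ m → (f : ℕ → ℚ) →
    ∑[ w < suc N ] (if wheelAdjℕ N i (toℕ w) then f (toℕ w) else 0ℚ) ≡ f N + (f (next i) + f (prev i))
  ∑-wheel-neighbours {i} i≤m f = ∑-over-three-points (wheelAdjℕ N i) f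
    (ℕP.n<1+n N) (s≤s (ℕP.m≤n⇒m≤1+n (next≤m i≤m))) (s≤s (ℕP.m≤n⇒m≤1+n (prev≤m i≤m)))
    (rim≢hub (next≤m i≤m) ∘ sym) (rim≢hub (prev≤m i≤m) ∘ sym) (next≢prev i≤m) (wheel-neighbours i≤m)

module _ where
  open import Data.Rational using (_+_; _-_; -_; _/_)
  open import Data.Integer using (+_)

  toℚᵘ-/ : ∀ a d → toℚᵘ (a / suc d) ℚᵘ.≃ mkℚᵘ a d
  toℚᵘ-/ a d = ℚP.toℚᵘ-fromℚᵘ (mkℚᵘ a d)

  /-distrib-+ : ∀ a b D .{{_ : NonZero D}} → (a ℤ.+ b) / D ≡ a / D + b / D
  /-distrib-+ a b D@(suc d) = ℚP.toℚᵘ-injective (ℚᵘP.≃-sym (begin-equality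
    toℚᵘ (a / D + b / D)                  ≃⟨ ℚP.toℚᵘ-homo-+ (a / D) (b / D) ⟩
    toℚᵘ (a / D) ℚᵘ.+ toℚᵘ (b / D)        ≃⟨ ℚᵘP.+-cong (toℚᵘ-/ a d) (toℚᵘ-/ b d) ⟩
    mkℚᵘ a d ℚᵘ.+ mkℚᵘ b d                ≃⟨ *≡* (common-denominator a b (+ D)) ⟩
    mkℚᵘ (a ℤ.+ b) d                      ≃⟨ toℚᵘ-/ (a ℤ.+ b) d ⟨
    toℚᵘ ((a ℤ.+ b) / D)                  ∎))
    where
    open ℚᵘP.≤-Reasoning
    common-denominator : ∀ a b D → (a ℤ.* D ℤ.+ b ℤ.* D) ℤ.* D ≡ (a ℤ.+ b) ℤ.* (D ℤ.* D)
    common-denominator = solve-∀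

  /-neg : ∀ a D .{{_ : NonZero D}} → (ℤ.- a) / D ≡ - (a / D)
  /-neg a D@(suc d) = ℚP.toℚᵘ-injective (ℚᵘP.≃-trans (toℚᵘ-/ (ℤ.- a) d)
    (ℚᵘP.≃-sym (ℚᵘP.≃-trans (ℚP.toℚᵘ-homo‿- (a / D)) (ℚᵘP.-‿cong (toℚᵘ-/ a d)))))

  /-distrib-- : ∀ a b D .{{_ : NonZero D}} → (a ℤ.- b) / D ≡ a / D - b / D
  /-distrib-- a b D = trans (/-distrib-+ a (ℤ.- b) D) (cong (λ x → a / D + x) (/-neg b D))

  n/n≡1 : ∀ D .{{_ : NonZero D}} → (+ D) / D ≡ 1ℚ
  n/n≡1 D@(suc d) = ℚP.toℚᵘ-injective (ℚᵘP.≃-trans (toℚᵘ-/ (+ D) d)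
    (*≡* (trans (ℤP.*-identityʳ (+ D)) (sym (ℤP.*-identityˡ (+ D))))))

module _ where
  open import Data.Integer using (+_; -[1+_]; _+_; _-_; _*_; -_)

  FibonacciLike : (ℤ → ℤ) → Set
  FibonacciLike G = ∀ x → G (+ 2 + x) ≡ G (1ℤ + x) + G x

  Recurrence₃ : (ℤ → ℤ) → Set
  Recurrence₃ g = ∀ t → g (1ℤ + t) + g (t - 1ℤ) ≡ + 3 * g t

  fibonacciLike-at : ∀ {G} → FibonacciLike G → ∀ y {a b} → + 2 + y ≡ a → 1ℤ + y ≡ b → G a ≡ G b + G y
  fibonacciLike-at rec y refl refl = rec y

  fibonacciLike-skip : ∀ {G} → FibonacciLike G → ∀ x → G (+ 2 + x) + G (x - + 2) ≡ + 3 * G x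
  fibonacciLike-skip {G} rec x = begin
    G (+ 2 + x) + G (x - + 2)                    ≡⟨ cong (_+ G (x - + 2)) (rec x) ⟩
    G (1ℤ + x) + G x + G (x - + 2)                ≡⟨ cong (λ y → y + G x + G (x - + 2)) step₁ ⟩
    G x + G (x - 1ℤ) + G x + G (x - + 2)          ≡⟨ regroup (G x) (G (x - 1ℤ)) (G (x - + 2)) ⟩
    G x + G x + (G (x - 1ℤ) + G (x - + 2))        ≡⟨ cong (λ y → G x + G x + y) step₂ ⟨
    G x + G x + G x                               ≡⟨ triple (G x) ⟩
    + 3 * G x                                     ∎
    where
    open ≡-Reasoning
    regroup : ∀ a b c → a + b + a + c ≡ a + a + (b + c)
    regroup = solve-∀
    triple : ∀ a → a + a + a ≡ + 3 * a
    triple = solve-∀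
    +2-1 : ∀ x → + 2 + (x - 1ℤ) ≡ 1ℤ + x
    +2-1 = solve-∀
    +1-1 : ∀ x → 1ℤ + (x - 1ℤ) ≡ x
    +1-1 = solve-∀
    +2-2 : ∀ x → + 2 + (x - + 2) ≡ x
    +2-2 = solve-∀
    +1-2 : ∀ x → 1ℤ + (x - + 2) ≡ x - 1ℤ
    +1-2 = solve-∀
    step₁ : G (1ℤ + x) ≡ G x + G (x - 1ℤ)
    step₁ = fibonacciLike-at {G} rec (x - 1ℤ) (+2-1 x) (+1-1 x)
    step₂ : G x ≡ G (x - 1ℤ) + G (x - + 2)
    step₂ = fibonacciLike-at {G} rec (x - + 2) (+2-2 x) (+1-2 x)

  bisection : ∀ {G} → FibonacciLike G → ∀ c → Recurrence₃ (λ t → G (c - + 2 * t))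
  bisection {G} rec c t = begin
    G (c - + 2 * (1ℤ + t)) + G (c - + 2 * (t - 1ℤ)) ≡⟨ cong₂ (λ a b → G a + G b) (down c t) (up c t) ⟩
    G (y - + 2) + G (+ 2 + y)                         ≡⟨ ℤP.+-comm (G (y - + 2)) _ ⟩
    G (+ 2 + y) + G (y - + 2)                         ≡⟨ fibonacciLike-skip {G} rec y ⟩
    + 3 * G y                                         ∎
    where
    open ≡-Reasoning
    y = c - + 2 * t
    down : ∀ c t → c - + 2 * (1ℤ + t) ≡ c - + 2 * t - + 2
    down = solve-∀
    up : ∀ c t → c - + 2 * (t - 1ℤ) ≡ + 2 + (c - + 2 * t)
    up = solve-∀

  recurrence₃-reflect : ∀ {g} → Recurrence₃ g → ∀ c → Recurrence₃ (λ t → g (c - t))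
  recurrence₃-reflect {g} rec c t = begin
    g (c - (1ℤ + t)) + g (c - (t - 1ℤ)) ≡⟨ cong₂ (λ a b → g a + g b) (down c t) (up c t) ⟩
    g (c - t - 1ℤ) + g (1ℤ + (c - t))    ≡⟨ ℤP.+-comm (g (c - t - 1ℤ)) _ ⟩
    g (1ℤ + (c - t)) + g (c - t - 1ℤ)    ≡⟨ rec (c - t) ⟩
    + 3 * g (c - t)                      ∎
    where
    open ≡-Reasoning
    down : ∀ c t → c - (1ℤ + t) ≡ c - t - 1ℤ
    down = solve-∀
    up : ∀ c t → c - (t - 1ℤ) ≡ 1ℤ + (c - t)
    up = solve-∀

  recurrence₃-unique : ∀ {g g′} → Recurrence₃ g → Recurrence₃ g′ → g 0ℤ ≡ g′ 0ℤ → g 1ℤ ≡ g′ 1ℤ →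
                       ∀ t → g (+ t) ≡ g′ (+ t)
  recurrence₃-unique {g} {g′} rec rec′ g₀ g₁ t = proj₁ (agree t)
    where
    agree : ∀ t → g (+ t) ≡ g′ (+ t) × g (+ suc t) ≡ g′ (+ suc t)
    agree zero    = g₀ , g₁
    agree (suc t) with agree t
    ... | gₜ , gₜ₊₁ = gₜ₊₁ , ℤ-Group.∙-cancelʳ (g (+ t)) _ _ (begin
      g (+ suc (suc t)) + g (+ t)   ≡⟨ rec (+ suc t) ⟩
      + 3 * g (+ suc t)             ≡⟨ cong (+ 3 *_) gₜ₊₁ ⟩
      + 3 * g′ (+ suc t)            ≡⟨ rec′ (+ suc t) ⟨
      g′ (+ suc (suc t)) + g′ (+ t) ≡⟨ cong (λ x → g′ (+ suc (suc t)) + x) gₜ ⟨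
      g′ (+ suc (suc t)) + g (+ t)  ∎)
      where open ≡-Reasoning

  private
    alternating-step : ∀ s a b → s * a ≡ - s * b + - - s * (b + a)
    alternating-step = solve-∀

  F-fibonacciLike : FibonacciLike F
  F-fibonacciLike (+ n)              = refl
  F-fibonacciLike -[1+ 0 ]           = refl
  F-fibonacciLike -[1+ 1 ]           = refl
  F-fibonacciLike -[1+ suc (suc n) ] = alternating-step (sgn n) (+ fib (suc n)) (+ fib (suc (suc n)))

  L-fibonacciLike : FibonacciLike L
  L-fibonacciLike (+ n)              = refl
  L-fibonacciLike -[1+ 0 ]           = refl
  L-fibonacciLike -[1+ 1 ]           = refl
  L-fibonacciLike -[1+ suc (suc n) ] = alternating-step (sgn (suc n)) (+ luc (suc n)) (+ luc (suc (suc n)))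

  sgn-even : ∀ k → sgn (k ℕ.* 2) ≡ + 1
  sgn-even zero    = refl
  sgn-even (suc k) = trans (ℤP.neg-involutive (sgn (k ℕ.* 2))) (sgn-even k)

  F-odd : ∀ k → F (- + suc (k ℕ.* 2)) ≡ F (+ suc (k ℕ.* 2))
  F-odd k = trans (cong (_* + fib (suc (k ℕ.* 2))) (sgn-even k)) (ℤP.*-identityˡ _)

  L-even : ∀ k → L (- + (k ℕ.* 2)) ≡ L (+ (k ℕ.* 2))
  L-even zero    = refl
  L-even (suc k) = trans (cong (_* + luc (suc k ℕ.* 2)) (sgn-even (suc k))) (ℤP.*-identityˡ _)

module WheelPotential (p : ℕ) (G : ℤ → ℤ) (G-fib : FibonacciLike G)
  (G-sym-N : G (ℤ.- ℤ.+ (3 ℕ.+ p)) ≡ G (ℤ.+ (3 ℕ.+ p)))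
  (G-sym-N-2 : G (ℤ.- ℤ.+ (1 ℕ.+ p)) ≡ G (ℤ.+ (1 ℕ.+ p)))
  (D : ℕ) .{{_ : NonZero D}} (D-def : ℤ.+ D ≡ G (ℤ.+ (2 ℕ.+ p)) ℤ.+ G (ℤ.+ (4 ℕ.+ p))) where

  open Rim p

  module _ where
    open import Data.Integer using (+_; -[1+_]; _+_; _-_; _*_; -_; +≤+)

    g : ℤ → ℤ
    g t = G (+ N - + 2 * t)

    g-reflect : ∀ t → g (+ N - + t) ≡ g (+ t)
    g-reflect = recurrence₃-unique {λ t → g (+ N - t)} {g}
      (recurrence₃-reflect {g} (bisection {G} G-fib (+ N)) (+ N)) (bisection {G} G-fib (+ N)) at-0 at-1
      where
      open ≡-Reasoning
      at-0 : g (+ N - 0ℤ) ≡ g 0ℤ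
      at-0 = begin
        G (+ N - + 2 * (+ N - 0ℤ)) ≡⟨ cong G (twice-back (+ N)) ⟩
        G (- + N)                  ≡⟨ G-sym-N ⟩
        G (+ N)                    ≡⟨ cong G (no-step (+ N)) ⟩
        G (+ N - + 2 * 0ℤ)         ∎
        where
        twice-back : ∀ x → x - + 2 * (x - 0ℤ) ≡ - x
        twice-back = solve-∀
        no-step : ∀ x → x ≡ x - + 2 * 0ℤ
        no-step = solve-∀
      at-1 : g (+ N - 1ℤ) ≡ g 1ℤ
      at-1 = trans (cong G (twice-back (+ N))) G-sym-N-2
        where
        twice-back : ∀ x → x - + 2 * (x - 1ℤ) ≡ - (x - + 2)
        twice-back = solve-∀

    g-0 : g 0ℤ ≡ G (+ N)
    g-0 = cong G (ℤP.+-identityʳ (+ N))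

    g∣∣ : ℤ → ℤ
    g∣∣ t = g (+ ℤ.∣ t ∣)

    g∣∣-neg : ∀ t → g∣∣ (- t) ≡ g∣∣ t
    g∣∣-neg t = cong (g ∘ +_) (ℤP.∣-i∣≡∣i∣ t)

    g∣∣-nonneg : ∀ {t} → 0ℤ ℤ.≤ t → g∣∣ t ≡ g t
    g∣∣-nonneg 0≤t = cong g (ℤP.0≤i⇒+∣i∣≡i 0≤t)

    g∣∣-rec : ∀ t → t ≢ 0ℤ → g∣∣ (1ℤ + t) + g∣∣ (t - 1ℤ) ≡ + 3 * g∣∣ t
    g∣∣-rec (+ zero)   t≢0 = contradiction refl t≢0
    g∣∣-rec (+ suc d)  _   = bisection {G} G-fib (+ N) (+ suc d)
    g∣∣-rec -[1+ d ]   _   = begin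
      g∣∣ (1ℤ + -[1+ d ]) + g∣∣ (-[1+ d ] - 1ℤ)
        ≡⟨ cong₂ _+_ (flip-sign (1ℤ + -[1+ d ]) (down -[1+ d ])) (flip-sign (-[1+ d ] - 1ℤ) (up -[1+ d ])) ⟩
      g∣∣ (+ suc d - 1ℤ) + g∣∣ (1ℤ + + suc d)  ≡⟨ ℤP.+-comm (g∣∣ (+ d)) _ ⟩
      g∣∣ (1ℤ + + suc d) + g∣∣ (+ suc d - 1ℤ)  ≡⟨ g∣∣-rec (+ suc d) (λ ()) ⟩
      + 3 * g∣∣ (+ suc d)                      ∎
      where
      open ≡-Reasoning
      flip-sign : ∀ t {s} → - t ≡ s → g∣∣ t ≡ g∣∣ s
      flip-sign t refl = sym (g∣∣-neg t)
      down : ∀ t → - (1ℤ + t) ≡ - t - 1ℤ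
      down = solve-∀
      up : ∀ t → - (t - 1ℤ) ≡ 1ℤ + - t
      up = solve-∀

    -- The Laplacian at rim vertex j for hub potential 0, with the rim unrolled to ℤ.
    Δ : (ℤ → ℤ) → ℤ → ℤ
    Δ f j = (f j - 0ℤ) + ((f j - f (1ℤ + j)) + (f j - f (j - 1ℤ)))

    Δ-harmonic : ∀ f j → f (1ℤ + j) + f (j - 1ℤ) ≡ + 3 * f j → Δ f j ≡ 0ℤ
    Δ-harmonic f j rec = begin
      Δ f j                                  ≡⟨ expand (f j) (f (1ℤ + j)) (f (j - 1ℤ)) ⟩
      + 3 * f j - (f (1ℤ + j) + f (j - 1ℤ))  ≡⟨ cong (λ x → + 3 * f j - x) rec ⟩
      + 3 * f j - + 3 * f j                  ≡⟨ ℤP.+-inverseʳ (+ 3 * f j) ⟩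
      0ℤ                                     ∎
      where
      open ≡-Reasoning
      expand : ∀ a b c → (a - 0ℤ) + ((a - b) + (a - c)) ≡ + 3 * a - (b + c)
      expand = solve-∀

    Δ-translate : ∀ f c j → Δ (λ x → f (x - c)) j ≡ Δ f (j - c)
    Δ-translate f c j =
      cong₂ (λ a b → (f (j - c) - 0ℤ) + ((f (j - c) - f a) + (f (j - c) - f b))) (up j c) (down j c)
      where
      up : ∀ j c → 1ℤ + j - c ≡ 1ℤ + (j - c)
      up = solve-∀
      down : ∀ j c → j - 1ℤ - c ≡ j - c - 1ℤ
      down = solve-∀

    Δ-linear : ∀ f f′ j → Δ (λ x → f x - f′ x) j ≡ Δ f j - Δ f′ j
    Δ-linear f f′ j = linear (f j) (f (1ℤ + j)) (f (j - 1ℤ)) (f′ j) (f′ (1ℤ + j)) (f′ (j - 1ℤ))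
      where
      linear : ∀ a b c a′ b′ c′ →
        ((a - a′) - 0ℤ) + (((a - a′) - (b - b′)) + ((a - a′) - (c - c′)))
        ≡ ((a - 0ℤ) + ((a - b) + (a - c))) - ((a′ - 0ℤ) + ((a′ - b′) + (a′ - c′)))
      linear = solve-∀

    Δg∣∣-0 : Δ g∣∣ 0ℤ ≡ + D
    Δg∣∣-0 = begin
      Δ g∣∣ 0ℤ                         ≡⟨ cong (λ x → (x - 0ℤ) + ((x - b) + (x - b))) g-0 ⟩
      (c - 0ℤ) + ((c - b) + (c - b))   ≡⟨ cong (λ x → (x - 0ℤ) + ((x - b) + (x - b))) c≡a+b ⟩
      (a + b - 0ℤ) + ((a + b - b) + (a + b - b)) ≡⟨ simplify a b ⟩
      a + ((a + b) + a)                ≡⟨ cong (λ x → a + (x + a)) c≡a+b ⟨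
      a + (c + a)                      ≡⟨ cong (λ x → a + x) (G-fib (+ m)) ⟨
      a + G (+ suc N)                  ≡⟨ D-def ⟨
      + D                              ∎
      where
      open ≡-Reasoning
      a = G (+ m)
      b = G (+ suc p)
      c = G (+ N)
      simplify : ∀ a b → (a + b - 0ℤ) + ((a + b - b) + (a + b - b)) ≡ a + ((a + b) + a)
      simplify = solve-∀
      c≡a+b : c ≡ a + b
      c≡a+b = G-fib (+ suc p)

    Δg∣∣-≢0 : ∀ {t} → t ≢ 0ℤ → Δ g∣∣ t ≡ 0ℤ
    Δg∣∣-≢0 {t} t≢0 = Δ-harmonic g∣∣ t (g∣∣-rec t t≢0)

    source : ℕ → ℤ → ℤ
    source a j = g∣∣ (j - + a)

    Δ-source : ∀ a i → Δ (source a) (+ i) ≡ (if i ≡ᵇ a then + D else 0ℤ)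
    Δ-source a i with i ≟ a
    ... | yes refl = trans (Δ-translate g∣∣ (+ a) (+ a))
                     (trans (cong (Δ g∣∣) (ℤP.+-inverseʳ (+ a))) (trans Δg∣∣-0 (sym (if-≡ᵇ-self a (+ D) 0ℤ))))
    ... | no  i≢a  = trans (Δ-translate g∣∣ (+ a) (+ i))
                     (trans (Δg∣∣-≢0 (i≢a ∘ ℤP.+-injective ∘ ℤP.i-j≡0⇒i≡j (+ i) (+ a))) (sym (if-≡ᵇ-≢ (+ D) 0ℤ i≢a)))

    source-origin : ∀ a → source a 0ℤ ≡ g (+ a)
    source-origin a = trans (cong g∣∣ (ℤP.+-identityˡ (- + a))) (g∣∣-neg (+ a))

    source-wrap-next : ∀ {a} → a ≤ m → source a (1ℤ + + m) ≡ source a 0ℤ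
    source-wrap-next {a} a≤m = begin
      g∣∣ (+ N - + a) ≡⟨ g∣∣-nonneg (ℤP.i≤j⇒0≤j-i (+≤+ (ℕP.m≤n⇒m≤1+n a≤m))) ⟩
      g (+ N - + a)   ≡⟨ g-reflect a ⟩
      g (+ a)         ≡⟨ source-origin a ⟨
      source a 0ℤ     ∎
      where open ≡-Reasoning

    source-wrap-prev : ∀ {a} → a ≤ m → source a (0ℤ - 1ℤ) ≡ source a (+ m)
    source-wrap-prev {a} a≤m = begin
      g∣∣ (0ℤ - 1ℤ - + a)   ≡⟨ cong g∣∣ (left-of-origin (+ a)) ⟩
      g∣∣ (- + suc a)       ≡⟨ g∣∣-neg (+ suc a) ⟩
      g (+ suc a)           ≡⟨ g-reflect (suc a) ⟨
      g (+ N - + suc a)     ≡⟨ cong g (cancel-1 (+ m) (+ a)) ⟩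
      g (+ m - + a)         ≡⟨ g∣∣-nonneg (ℤP.i≤j⇒0≤j-i (+≤+ a≤m)) ⟨
      g∣∣ (+ m - + a)       ∎
      where
      open ≡-Reasoning
      left-of-origin : ∀ x → 0ℤ - 1ℤ - x ≡ - (1ℤ + x)
      left-of-origin = solve-∀
      cancel-1 : ∀ x y → 1ℤ + x - (1ℤ + y) ≡ x - y
      cancel-1 = solve-∀

    dipole : ℕ → ℤ → ℤ
    dipole k j = source 0 j - source k j

    Δ-dipole : ∀ k i → Δ (dipole k) (+ i) ≡ (if i ≡ᵇ 0 then + D else 0ℤ) - (if i ≡ᵇ k then + D else 0ℤ)
    Δ-dipole k i = trans (Δ-linear (source 0) (source k) (+ i)) (cong₂ _-_ (Δ-source 0 i) (Δ-source k i))

    dipole-wrap-next : ∀ {k} → k ≤ m → dipole k (1ℤ + + m) ≡ dipole k 0ℤ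
    dipole-wrap-next k≤m = cong₂ _-_ (source-wrap-next z≤n) (source-wrap-next k≤m)

    dipole-wrap-prev : ∀ {k} → k ≤ m → dipole k (0ℤ - 1ℤ) ≡ dipole k (+ m)
    dipole-wrap-prev k≤m = cong₂ _-_ (source-wrap-prev z≤n) (source-wrap-prev k≤m)

    dipole-drop : ∀ k → dipole k 0ℤ - dipole k (+ k) ≡ + 2 * (G (+ N) - G (+ N - + (2 ℕ.* k)))
    dipole-drop k = begin
      (g 0ℤ - source k 0ℤ) - (source 0 (+ k) - source k (+ k))
        ≡⟨ cong₂ (λ x y → (g 0ℤ - x) - (y - source k (+ k))) (source-origin k) (cong (g ∘ +_) (ℕP.+-identityʳ k)) ⟩
      (g 0ℤ - g (+ k)) - (g (+ k) - g∣∣ (+ k - + k))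
        ≡⟨ cong (λ x → (g 0ℤ - g (+ k)) - (g (+ k) - g∣∣ x)) (ℤP.+-inverseʳ (+ k)) ⟩
      (g 0ℤ - g (+ k)) - (g (+ k) - g 0ℤ)
        ≡⟨ antisymmetric (g 0ℤ) (g (+ k)) ⟩
      + 2 * (g 0ℤ - g (+ k))
        ≡⟨ cong₂ (λ x y → + 2 * (x - G (+ N - y))) g-0 (sym (ℤP.pos-* 2 k)) ⟩
      + 2 * (G (+ N) - G (+ N - + (2 ℕ.* k))) ∎
      where
      open ≡-Reasoning
      antisymmetric : ∀ a b → (a - b) - (b - a) ≡ + 2 * (a - b)
      antisymmetric = solve-∀

    grounded : (ℤ → ℤ) → ℕ → ℤ
    grounded f j = if j ≡ᵇ N then 0ℤ else f (+ j)

    grounded-rim : ∀ f {i} → i ≤ m → grounded f i ≡ f (+ i)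
    grounded-rim f i≤m = if-≡ᵇ-≢ 0ℤ _ (rim≢hub i≤m)

    grounded-next : ∀ f → f (1ℤ + + m) ≡ f 0ℤ → ∀ {i} → i ≤ m → grounded f (next i) ≡ f (1ℤ + + i)
    grounded-next f wrap {i} i≤m with i ≟ m
    ... | yes refl = trans (cong (grounded f) next-last) (sym wrap)
    ... | no  i≢m  = trans (cong (grounded f) (next-≢ i≢m)) (grounded-rim f (ℕP.≤∧≢⇒< i≤m i≢m))

    grounded-prev : ∀ f → f (0ℤ - 1ℤ) ≡ f (+ m) → ∀ {i} → i ≤ m → grounded f (prev i) ≡ f (+ i - 1ℤ)
    grounded-prev f wrap {zero}  _   = trans (grounded-rim f ℕP.≤-refl) (sym wrap)
    grounded-prev f wrap {suc i} i<m = grounded-rim f (ℕP.<⇒≤ i<m)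

    grounded-Δ : ∀ f → f (1ℤ + + m) ≡ f 0ℤ → f (0ℤ - 1ℤ) ≡ f (+ m) → ∀ {i} → i ≤ m →
      (grounded f i - grounded f N) + ((grounded f i - grounded f (next i)) + (grounded f i - grounded f (prev i)))
      ≡ Δ f (+ i)
    grounded-Δ f wrap-next wrap-prev {i} i≤m = trans
      (cong₂ (λ x y → (x - y) + ((x - grounded f (next i)) + (x - grounded f (prev i))))
             (grounded-rim f i≤m) (if-≡ᵇ-self N 0ℤ _))
      (cong₂ (λ x y → (f (+ i) - 0ℤ) + ((f (+ i) - x) + (f (+ i) - y)))
             (grounded-next f wrap-next i≤m) (grounded-prev f wrap-prev i≤m))

  module _ where
    open import Data.Rational using (_+_; _-_; _/_)

    wheelAdj-sym : ∀ u w → wheelAdj N u w ≡ wheelAdj N w u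
    wheelAdj-sym u w = wheelAdjℕ-sym N (toℕ u) (toℕ w)

    if-D/D : ∀ b → (if b then ℤ.+ D else 0ℤ) / D ≡ (if b then 1ℚ else 0ℚ)
    if-D/D true  = n/n≡1 D
    if-D/D false = ℚP.0/n≡0 D

    potential : Fin (suc N) → Fin (suc N) → ℚ
    potential l w = grounded (dipole (toℕ l)) (toℕ w) / D

    rim-kirchhoff : ∀ l → toℕ l ≤ m → ∀ u → toℕ u ≤ m →
                    laplacian (suc N) (wheelAdj N) (potential l) u ≡ unitCurrent (suc N) zero l u
    rim-kirchhoff l k≤m u i≤m = begin
      laplacian (suc N) (wheelAdj N) (potential l) u
        ≡⟨ sumFin≡sum (suc N) (λ w → if wheelAdjℕ N i (toℕ w) then φ i - φ (toℕ w) else 0ℚ) ⟩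
      ∑[ w < suc N ] (if wheelAdjℕ N i (toℕ w) then φ i - φ (toℕ w) else 0ℚ)
        ≡⟨ ∑-wheel-neighbours i≤m (λ j → φ i - φ j) ⟩
      (φ i - φ N) + ((φ i - φ (next i)) + (φ i - φ (prev i)))
        ≡⟨ over-D (v i) (v N) (v (next i)) (v (prev i)) ⟩
      ((v i ℤ.- v N) ℤ.+ ((v i ℤ.- v (next i)) ℤ.+ (v i ℤ.- v (prev i)))) / D
        ≡⟨ cong (_/ D) (grounded-Δ (dipole k) (dipole-wrap-next k≤m) (dipole-wrap-prev k≤m) i≤m) ⟩
      Δ (dipole k) (ℤ.+ i) / D
        ≡⟨ cong (_/ D) (Δ-dipole k i) ⟩
      ((if i ≡ᵇ 0 then ℤ.+ D else 0ℤ) ℤ.- (if i ≡ᵇ k then ℤ.+ D else 0ℤ)) / D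
        ≡⟨ /-distrib-- (if i ≡ᵇ 0 then ℤ.+ D else 0ℤ) (if i ≡ᵇ k then ℤ.+ D else 0ℤ) D ⟩
      (if i ≡ᵇ 0 then ℤ.+ D else 0ℤ) / D - (if i ≡ᵇ k then ℤ.+ D else 0ℤ) / D
        ≡⟨ cong₂ _-_ (if-D/D (i ≡ᵇ 0)) (if-D/D (i ≡ᵇ k)) ⟩
      unitCurrent (suc N) zero l u ∎
      where
      open ≡-Reasoning
      i = toℕ u
      k = toℕ l
      v = grounded (dipole k)
      φ : ℕ → ℚ
      φ j = v j / D
      over-D : ∀ a b c d → (a / D - b / D) + ((a / D - c / D) + (a / D - d / D))
                           ≡ ((a ℤ.- b) ℤ.+ ((a ℤ.- c) ℤ.+ (a ℤ.- d))) / D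
      over-D a b c d = sym (begin
        ((a ℤ.- b) ℤ.+ ((a ℤ.- c) ℤ.+ (a ℤ.- d))) / D
          ≡⟨ /-distrib-+ (a ℤ.- b) ((a ℤ.- c) ℤ.+ (a ℤ.- d)) D ⟩
        (a ℤ.- b) / D + ((a ℤ.- c) ℤ.+ (a ℤ.- d)) / D
          ≡⟨ cong ((a ℤ.- b) / D +_) (/-distrib-+ (a ℤ.- c) (a ℤ.- d) D) ⟩
        (a ℤ.- b) / D + ((a ℤ.- c) / D + (a ℤ.- d) / D)
          ≡⟨ cong₂ _+_ (/-distrib-- a b D) (cong₂ _+_ (/-distrib-- a c D) (/-distrib-- a d D)) ⟩
        (a / D - b / D) + ((a / D - c / D) + (a / D - d / D)) ∎)

    rim-vertex : ∀ (u : Fin (suc N)) → u ≢ Fin.fromℕ N → toℕ u ≤ m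
    rim-vertex u u≢hub = ℕ.s≤s⁻¹ (ℕP.≤∧≢⇒< (FinP.toℕ≤pred[n] u)
                           (λ u≡N → u≢hub (FinP.toℕ-injective (trans u≡N (sym (FinP.toℕ-fromℕ N))))))

    potential-isPotential : ∀ l → toℕ l ≤ m → IsPotential (suc N) (wheelAdj N) zero l (potential l)
    potential-isPotential l k≤m =
      Network.isPotential-except (wheelAdj N) wheelAdj-sym {φ = potential l} (Fin.fromℕ N)
        (λ u u≢hub → rim-kirchhoff l k≤m u (rim-vertex u u≢hub))

    potential-drop : ∀ l → toℕ l ≤ m →
      potential l zero - potential l l ≡ (ℤ.+ 2 ℤ.* (G (ℤ.+ N) ℤ.- G (ℤ.+ N ℤ.- ℤ.+ (2 ℕ.* toℕ l)))) / D
    potential-drop l k≤m = begin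
      v 0 / D - v k / D                 ≡⟨ /-distrib-- (v 0) (v k) D ⟨
      (v 0 ℤ.- v k) / D                 ≡⟨ cong (λ x → (dipole k 0ℤ ℤ.- x) / D) (grounded-rim (dipole k) k≤m) ⟩
      (dipole k 0ℤ ℤ.- dipole k (ℤ.+ k)) / D ≡⟨ cong (_/ D) (dipole-drop k) ⟩
      (ℤ.+ 2 ℤ.* (G (ℤ.+ N) ℤ.- G (ℤ.+ N ℤ.- ℤ.+ (2 ℕ.* k)))) / D ∎
      where
      open ≡-Reasoning
      k = toℕ l
      v = grounded (dipole k)

    wheel-effectiveResistance : ∀ l → toℕ l < N → IsEffectiveResistance (suc N) (wheelAdj N) zero l
      ((ℤ.+ 2 ℤ.* (G (ℤ.+ N) ℤ.- G (ℤ.+ N ℤ.- ℤ.+ (2 ℕ.* toℕ l)))) / D)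
    wheel-effectiveResistance l l<N =
      subst (IsEffectiveResistance (suc N) (wheelAdj N) zero l) (potential-drop l k≤m)
        (Network.isEffectiveResistance (wheelAdj N) wheelAdj-sym {φ = potential l} (potential-isPotential l k≤m))
      where
      k≤m = ℕ.s≤s⁻¹ l<N

wheel-resistance-odd : ∀ N → 3 ≤ N → (l : Fin (suc N)) → toℕ l < N → Odd N →
                       IsEffectiveResistance (suc N) (wheelAdj N) zero l (oddFormula N (toℕ l))
wheel-resistance-odd _ (s≤s ()) _ _ (zero , refl)
wheel-resistance-odd _ _ l l<N (suc k , refl) =
  WheelPotential.wheel-effectiveResistance (k ℕ.* 2) F F-fibonacciLike (F-odd (suc k)) (F-odd k)
    (fib m ℕ.+ fib (suc (suc m))) {{fib-den-nz m}} refl l l<N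
  where m = suc (suc (k ℕ.* 2))

wheel-resistance-even : ∀ N → 3 ≤ N → (l : Fin (suc N)) → toℕ l < N → Even N →
                        IsEffectiveResistance (suc N) (wheelAdj N) zero l (evenFormula N (toℕ l))
wheel-resistance-even _ ()               _ _ (zero , refl)
wheel-resistance-even _ (s≤s (s≤s ())) _ _ (suc zero , refl)
wheel-resistance-even _ _ l l<N (suc (suc k) , refl) =
  WheelPotential.wheel-effectiveResistance (suc (k ℕ.* 2)) L L-fibonacciLike (L-even (suc (suc k))) (L-even (suc k))
    (luc m ℕ.+ luc (suc (suc m))) {{luc-den-nz m}} refl l l<N
  where m = suc (suc (suc (k ℕ.* 2)))

lemma3 : (N : ℕ) → 3 ≤ N → (l : Fin (suc N)) → 1 ≤ toℕ l → toℕ l < N →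
    (Odd N → IsEffectiveResistance (suc N) (wheelAdj N) zero l (oddFormula N (toℕ l)))
    × (Even N → IsEffectiveResistance (suc N) (wheelAdj N) zero l (evenFormula N (toℕ l)))
lemma3 N 3≤N l _ l<N = wheel-resistance-odd N 3≤N l l<N , wheel-resistance-even N 3≤N l l<N
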